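{- Let $\Sigma$ be an alphabet with converse and $S$ a CFCST system over $\Sigma$. Every proof of a labelled sequent $\mathcal{R},R_\chi wu\Rightarrow\Gamma$ in $\mathsf{Km}(S)\mathsf{L}$ can be algorithmically transformed into a proof of $\mathcal{R},R_{\overline{\chi}}uw\Rightarrow\Gamma$ in $\mathsf{Km}(S)\mathsf{L}$ of the same height or less, and vice versa.
   Context: Alphabet with converse: finite $\Sigma$ with involution $\chi\mapsto\overline{\chi}$; $\overline{\chi_1\cdots\chi_n}=\overline{\chi_n}\cdots\overline{\chi_1}$, $\overline{\varepsilon}=\varepsilon$. A CFCST system $S$ is a set of rules $\chi\to s$ ($\chi\in\Sigma$, $s\in\Sigma^*$) closed under $\chi\to s\in S\Rightarrow\overline{\chi}\to\overline{s}\in S$; $L_S(\chi)$ is the set of strings obtainable from $\chi$ by zero or more rewrites $t\chi't'\mapsto ts't'$ with $\chi'\to s'\in S$. Formulas: $\phi::=p\mid\overline{p}\mid\phi\vee\phi\mid\phi\wedge\phi\mid\langle\chi\rangle\phi\mid[\chi]\phi$. Labelled sequents $\mathcal{R}\Rightarrow\Gamma$: $\mathcal{R}$ a multiset of relational atoms $R_\chi wu$, $\Gamma$ a multiset of labelled formulas. Propagation graph: vertices the labels of the sequent, edges $(w,u,\chi)$ and $(u,w,\overline{\chi})$ for each $R_\chi wu\in\mathcal{R}$; path strings are the sequences of edge labels (length-$0$ path: $\varepsilon$). $\mathsf{Km}(S)\mathsf{L}$: $(id)$: $\mathcal{R}\Rightarrow w:p,w:\overline{p},\Gamma$; $(\vee_r)$: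 $\mathcal{R}\Rightarrow w:\phi,w:\psi,\Gamma$ / $\mathcal{R}\Rightarrow w:\phi\vee\psi,\Gamma$; $(\wedge_r)$: $\mathcal{R}\Rightarrow w:\phi,\Gamma$ and $\mathcal{R}\Rightarrow w:\psi,\Gamma$ / $\mathcal{R}\Rightarrow w:\phi\wedge\psi,\Gamma$; $([\chi])$: $\mathcal{R},R_\chi wu\Rightarrow u:\phi,\Gamma$ / $\mathcal{R}\Rightarrow w:[\chi]\phi,\Gamma$ with $u$ not in the conclusion; $(Pr_{\langle\chi\rangle})$: $\mathcal{R}\Rightarrow w:\langle\chi\rangle\phi,u:\phi,\Gamma$ / $\mathcal{R}\Rightarrow w:\langle\chi\rangle\phi,\Gamma$ provided some propagation path from $w$ to $u$ has string in $L_S(\chi)$. The height of a proof is the maximal number of sequents on a branch from the end sequent to a leaf. -}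

module Defs where

open import Data.Nat using (ℕ; suc; _≤_; _⊔_)
open import Data.Fin using (Fin)
open import Data.List using (List; []; _∷_; [_]; _++_; map; reverse; concatMap)
open import Data.List.Membership.Propositional using (_∈_; _∉_)
open import Data.List.Relation.Binary.Permutation.Propositional using (_↭_)
open import Data.Product using (Σ; _×_; _,_)
open import Data.Sum using (_⊎_)
open import Relation.Binary.PropositionalEquality using (_≡_)

record Alphabet : Set where
  field
    size       : ℕ
    conv       : Fin size → Fin size
    conv-invol : ∀ x → conv (conv x) ≡ x

module _ (A : Alphabet) where
  open Alphabet A

  Chr : Set
  Chr = Fin size

  convStr : List Chr → List Chr
  convStr s = reverse (map conv s)

  record CFCST : Set₁ where
    field
      Rule   : Chr → List Chr → Set
      closed : ∀ {c s} → Rule c s → Rule (conv c) (convStr s)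

module Calc (A : Alphabet) (S : CFCST A) where
  open Alphabet A
  open CFCST S

  Ch : Set
  Ch = Chr A

  data Step : List Ch → List Ch → Set where
    step : ∀ t t' c s → Rule c s → Step (t ++ c ∷ t') (t ++ s ++ t')

  data Steps : List Ch → List Ch → Set where
    done : ∀ {s} → Steps s s
    more : ∀ {s t u} → Step s t → Steps t u → Steps s u

  L : Ch → List Ch → Set
  L c s = Steps [ c ] s

  -- formulas (propositional variables indexed by ℕ; p̄ written natom)
  data Fm : Set where
    atom  : ℕ → Fm
    natom : ℕ → Fm
    _∨_   : Fm → Fm → Fm
    _∧_   : Fm → Fm → Fm
    dia   : Ch → Fm → Fm
    box   : Ch → Fm → Fm

  Label : Set
  Label = ℕ

  record RelAtom : Set where
    constructor rel
    field
      chr : Ch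
      src : Label
      tgt : Label

  record LFm : Set where
    constructor _∶_
    field
      lab : Label
      fm  : Fm

  -- multisets represented by lists; rules act up to permutation (_↭_)
  labelsR : List RelAtom → List Label
  labelsR []              = []
  labelsR (rel _ w u ∷ R) = w ∷ u ∷ labelsR R

  labelsΓ : List LFm → List Label
  labelsΓ []            = []
  labelsΓ ((w ∶ _) ∷ Γ) = w ∷ labelsΓ Γ

  data Edge (R : List RelAtom) : Label → Label → Ch → Set where
    fwd : ∀ {c w u} → rel c w u ∈ R → Edge R w u c
    bwd : ∀ {c w u} → rel c w u ∈ R → Edge R u w (conv c)

  data Path (R : List RelAtom) : Label → Label → List Ch → Set where
    here : ∀ {w} → Path R w w []
    next : ∀ {w v u c s} → Edge R w v c → Path R v u s → Path R w u (c ∷ s)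

  data Proof (R : List RelAtom) (Γ : List LFm) : Set where
    ax   : ∀ {w p Δ} → Γ ↭ ((w ∶ atom p) ∷ (w ∶ natom p) ∷ Δ) → Proof R Γ
    orR  : ∀ {w φ ψ Δ} → Γ ↭ ((w ∶ (φ ∨ ψ)) ∷ Δ) →
           Proof R ((w ∶ φ) ∷ (w ∶ ψ) ∷ Δ) → Proof R Γ
    andR : ∀ {w φ ψ Δ} → Γ ↭ ((w ∶ (φ ∧ ψ)) ∷ Δ) →
           Proof R ((w ∶ φ) ∷ Δ) → Proof R ((w ∶ ψ) ∷ Δ) → Proof R Γ
    boxR : ∀ {w u c φ Δ} → Γ ↭ ((w ∶ box c φ) ∷ Δ) →
           u ∉ labelsR R → u ∉ labelsΓ Γ →
           Proof (rel c w u ∷ R) ((u ∶ φ) ∷ Δ) → Proof R Γ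
    prop : ∀ {w u c φ s Δ} → Γ ↭ ((w ∶ dia c φ) ∷ Δ) →
           Path R w u s → L c s →
           Proof R ((w ∶ dia c φ) ∷ (u ∶ φ) ∷ Δ) → Proof R Γ

  height : ∀ {R Γ} → Proof R Γ → ℕ
  height (ax _)         = 1
  height (orR _ d)      = suc (height d)
  height (andR _ d e)   = suc (height d ⊔ height e)
  height (boxR _ _ _ d) = suc (height d)
  height (prop _ _ _ d) = suc (height d)

{-# OPTIONS --safe #-}
module Submission where

-- A proof in Km(S)L sees its relational part only through the edges of the
-- propagation graph (side condition of Pr⟨χ⟩) and through its labels
-- (freshness in [χ]).  The atoms R_χ w u and R_χ̄ u w generate the same two
-- edges (w,u,χ) and (u,w,χ̄), because χ̄̄ = χ, and mention the same labels, so
-- the same proof tree, rule by rule, proves the other sequent with the same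
-- height.

open import Defs
open import Data.Nat using (suc; _≤_; _⊔_)
open import Data.Nat.Properties using (≤-reflexive)
open import Data.List using (List; _∷_)
open import Data.List.Relation.Unary.Any using (here; there)
open import Data.List.Relation.Binary.Subset.Propositional using (_⊆_)
open import Data.List.Relation.Binary.Subset.Propositional.Properties using (∷⁺ʳ)
open import Data.List.Relation.Binary.Permutation.Propositional using (↭-swap; ↭-refl)
open import Data.List.Relation.Binary.Permutation.Propositional.Properties using (∈-resp-↭)
open import Data.Product using (Σ; _×_; _,_)
open import Relation.Binary.PropositionalEquality using (_≡_; refl; sym; subst; cong; cong₂)

module _ (A : Alphabet) (S : CFCST A) where
  open Alphabet A
  open Calc A S

  _⊆ᴱ_ : List RelAtom → List RelAtom → Set
  R ⊆ᴱ R′ = ∀ {v v′ c} → Edge R v v′ c → Edge R′ v v′ c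

  Edge-there : ∀ {R v v′ c} a → Edge R v v′ c → Edge (a ∷ R) v v′ c
  Edge-there a (fwd m) = fwd (there m)
  Edge-there a (bwd m) = bwd (there m)

  ∷⁺ᴱ : ∀ {R R′} a → R ⊆ᴱ R′ → (a ∷ R) ⊆ᴱ (a ∷ R′)
  ∷⁺ᴱ a R⊆R′ (fwd (here refl)) = fwd (here refl)
  ∷⁺ᴱ a R⊆R′ (bwd (here refl)) = bwd (here refl)
  ∷⁺ᴱ a R⊆R′ (fwd (there m))   = Edge-there a (R⊆R′ (fwd m))
  ∷⁺ᴱ a R⊆R′ (bwd (there m))   = Edge-there a (R⊆R′ (bwd m))

  map-Path : ∀ {R R′} → R ⊆ᴱ R′ → ∀ {v v′ s} → Path R v v′ s → Path R′ v v′ s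
  map-Path R⊆R′ here       = here
  map-Path R⊆R′ (next e p) = next (R⊆R′ e) (map-Path R⊆R′ p)

  labelsR-∷⁺ : ∀ {R R′} a → labelsR R′ ⊆ labelsR R → labelsR (a ∷ R′) ⊆ labelsR (a ∷ R)
  labelsR-∷⁺ (rel _ v v′) L′⊆L = ∷⁺ʳ v (∷⁺ʳ v′ L′⊆L)

  transfer : ∀ {R R′ Γ} → R ⊆ᴱ R′ → labelsR R′ ⊆ labelsR R → Proof R Γ → Proof R′ Γ
  transfer E L (ax p)              = ax p
  transfer E L (orR p d)           = orR p (transfer E L d)
  transfer E L (andR p d e)        = andR p (transfer E L d) (transfer E L e)
  transfer E L (boxR {w} {u} {c} p u∉R u∉Γ d) =
    boxR p (λ u∈R′ → u∉R (L u∈R′)) u∉Γ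
         (transfer (∷⁺ᴱ (rel c w u) E) (labelsR-∷⁺ (rel c w u) L) d)
  transfer E L (prop p path inL d) = prop p (map-Path E path) inL (transfer E L d)

  height-transfer : ∀ {R R′ Γ} (E : R ⊆ᴱ R′) (L : labelsR R′ ⊆ labelsR R) (d : Proof R Γ) →
                    height (transfer E L d) ≡ height d
  height-transfer E L (ax p)         = refl
  height-transfer E L (orR p d)      = cong suc (height-transfer E L d)
  height-transfer E L (andR p d e)   =
    cong suc (cong₂ _⊔_ (height-transfer E L d) (height-transfer E L e))
  height-transfer E L (boxR {w} {u} {c} p _ _ d) =
    cong suc (height-transfer (∷⁺ᴱ (rel c w u) E) (labelsR-∷⁺ (rel c w u) L) d)
  height-transfer E L (prop p _ _ d) = cong suc (height-transfer E L d)

  module _ {R : List RelAtom} {c c′ : Ch} {w u : Label}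
           (c′≡c̄ : c′ ≡ conv c) (c̄′≡c : conv c′ ≡ c) where

    converse-⊆ᴱ : (rel c w u ∷ R) ⊆ᴱ (rel c′ u w ∷ R)
    converse-⊆ᴱ (fwd (here refl)) = subst (Edge (rel c′ u w ∷ R) w u) c̄′≡c (bwd (here refl))
    converse-⊆ᴱ (bwd (here refl)) = subst (Edge (rel c′ u w ∷ R) u w) c′≡c̄ (fwd (here refl))
    converse-⊆ᴱ (fwd (there m))   = fwd (there m)
    converse-⊆ᴱ (bwd (there m))   = bwd (there m)

    converse-labelsR : labelsR (rel c′ u w ∷ R) ⊆ labelsR (rel c w u ∷ R)
    converse-labelsR = ∈-resp-↭ (↭-swap u w ↭-refl)

    converse-transfer : ∀ {Γ} (d : Proof (rel c w u ∷ R) Γ) →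
                        Σ (Proof (rel c′ u w ∷ R) Γ) (λ d′ → height d′ ≤ height d)
    converse-transfer d =
      transfer converse-⊆ᴱ converse-labelsR d ,
      ≤-reflexive (height-transfer converse-⊆ᴱ converse-labelsR d)

mainTheorem5 : (A : Alphabet) (S : CFCST A) →
    let open Alphabet A
        open Calc A S
    in (R : List RelAtom) (Γ : List LFm) (c : Ch) (w u : Label) →
       ((d : Proof (rel c w u ∷ R) Γ) →
          Σ (Proof (rel (conv c) u w ∷ R) Γ) (λ d′ → height d′ ≤ height d))
       ×
       ((d : Proof (rel (conv c) u w ∷ R) Γ) →
          Σ (Proof (rel c w u ∷ R) Γ) (λ d′ → height d′ ≤ height d))
mainTheorem5 A S R Γ c w u =
  converse-transfer A S refl (conv-invol c) ,
  converse-transfer A S (sym (conv-invol c)) refl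
  where open Alphabet A
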